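{- Let $(A,\rightarrow,\rightsquigarrow,1)$ be a linearly ordered pseudo-BE algebra. Then every internal state of type II on $A$ is a state-morphism operator on $A$, i.e. $\mathcal{IS}^{(II)}(A)\subseteq\mathcal{SMO}(A)$.
   Context: A pseudo-BE algebra is an algebra $(A,\rightarrow,\rightsquigarrow,1)$ of type $(2,2,0)$ such that for all $x,y,z\in A$: $x\rightarrow x=x\rightsquigarrow x=1$; $x\rightarrow 1=x\rightsquigarrow 1=1$; $1\rightarrow x=1\rightsquigarrow x=x$; $x\rightarrow(y\rightsquigarrow z)=y\rightsquigarrow(x\rightarrow z)$; $x\rightarrow y=1$ iff $x\rightsquigarrow y=1$. Write $x\le y$ iff $x\rightarrow y=1$; linearly ordered means any $x,y$ satisfy $x\le y$ or $y\le x$. Put $x\vee_1 y=(x\rightarrow y)\rightsquigarrow y$ and $x\vee_2 y=(x\rightsquigarrow y)\rightarrow y$. An internal state of type II is a map $\mu:A\to A$ such that for all $x,y$: (is1) $x\le y$ implies $\mu(x)\le\mu(y)$; (is2') $\mu(x\rightarrow y)=\mu(y\vee_1 x)\rightarrow\mu(y)$ and $\mu(x\rightsquigarrow y)=\mu(y\vee_2 x)\rightsquigarrow\mu(y)$; (is3) $\mu(\mu(x)\rightarrow\mu(y))=\mu(x)\rightarrow\mu(y)$ and $\mu(\mu(x)\rightsquigarrow\mu(y))=\mu(x)\rightsquigarrow\mu(y)$. A state-morphism operator is a map $\mu:A\to A$ with $\mu(x\rightarrow y)=\mu(x)\rightarrow\mu(y)$, $\mu(x\rightsquigarrow y)=\mu(x)\rightsquigarrow\mu(y)$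 for all $x,y$, and $\mu\circ\mu=\mu$. -}

module Defs where

open import Level using (Level; suc)
open import Relation.Binary.PropositionalEquality using (_≡_)
open import Data.Sum using (_⊎_)
open import Data.Product using (_×_)
open import Function.Bundles using (_⇔_)

record PseudoBE (a : Level) : Set (suc a) where
  infixr 5 _⇒_ _⇝_
  field
    Carrier : Set a
    _⇒_     : Carrier → Carrier → Carrier
    _⇝_     : Carrier → Carrier → Carrier
    𝟏       : Carrier
    ⇒-refl  : ∀ x → x ⇒ x ≡ 𝟏
    ⇝-refl  : ∀ x → x ⇝ x ≡ 𝟏
    ⇒-top   : ∀ x → x ⇒ 𝟏 ≡ 𝟏
    ⇝-top   : ∀ x → x ⇝ 𝟏 ≡ 𝟏
    ⇒-unit  : ∀ x → 𝟏 ⇒ x ≡ x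
    ⇝-unit  : ∀ x → 𝟏 ⇝ x ≡ x
    exch    : ∀ x y z → x ⇒ (y ⇝ z) ≡ y ⇝ (x ⇒ z)
    ⇒⇔⇝     : ∀ x y → (x ⇒ y ≡ 𝟏) ⇔ (x ⇝ y ≡ 𝟏)

  infix 4 _≤_
  _≤_ : Carrier → Carrier → Set a
  x ≤ y = x ⇒ y ≡ 𝟏

  _∨₁_ : Carrier → Carrier → Carrier
  x ∨₁ y = (x ⇒ y) ⇝ y

  _∨₂_ : Carrier → Carrier → Carrier
  x ∨₂ y = (x ⇝ y) ⇒ y

module _ {a : Level} (A : PseudoBE a) where
  open PseudoBE A

  LinearlyOrdered : Set a
  LinearlyOrdered = ∀ x y → x ≤ y ⊎ y ≤ x

  record IsInternalStateII (μ : Carrier → Carrier) : Set a where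
    field
      is1   : ∀ {x y} → x ≤ y → μ x ≤ μ y
      is2′⇒ : ∀ x y → μ (x ⇒ y) ≡ μ (y ∨₁ x) ⇒ μ y
      is2′⇝ : ∀ x y → μ (x ⇝ y) ≡ μ (y ∨₂ x) ⇝ μ y
      is3⇒  : ∀ x y → μ (μ x ⇒ μ y) ≡ μ x ⇒ μ y
      is3⇝  : ∀ x y → μ (μ x ⇝ μ y) ≡ μ x ⇝ μ y

  record IsStateMorphismOperator (μ : Carrier → Carrier) : Set a where
    field
      hom⇒ : ∀ x y → μ (x ⇒ y) ≡ μ x ⇒ μ y
      hom⇝ : ∀ x y → μ (x ⇝ y) ≡ μ x ⇝ μ y
      idem : ∀ x → μ (μ x) ≡ μ x

module Submission where

-- When y ≤ x the join
-- y ∨₁ x = (y → x) ⇝ x collapses to 1 ⇝ x = x, so (is2') becomes exactly the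
-- homomorphism law μ(x → y) = μ(x) → μ(y).  When x ≤ y instead, both sides equal
-- 1, because μ is monotone (is1) and μ(1) = 1.  Linearity says one of the two
-- cases always holds; the same argument works for ⇝ with ∨₂.  Idempotence
-- follows from (is3) applied to 1 → x, again using μ(1) = 1.

open import Defs
open import Level using (Level)
open import Relation.Binary.PropositionalEquality using (_≡_; sym; trans; cong; module ≡-Reasoning)
open import Data.Sum using (inj₁; inj₂)
open import Function.Bundles using (Equivalence)

module OrderFacts {a : Level} (A : PseudoBE a) where
  open PseudoBE A

  ≤⇒⇝-top : ∀ {x y} → x ≤ y → x ⇝ y ≡ 𝟏
  ≤⇒⇝-top {x} {y} = Equivalence.to (⇒⇔⇝ x y)

  ∨₁-absorb : ∀ {x y} → y ≤ x → y ∨₁ x ≡ x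
  ∨₁-absorb {x} {y} y≤x = begin
    (y ⇒ x) ⇝ x  ≡⟨ cong (_⇝ x) y≤x ⟩
    𝟏 ⇝ x        ≡⟨ ⇝-unit x ⟩
    x            ∎
    where open ≡-Reasoning

  ∨₂-absorb : ∀ {x y} → y ≤ x → y ∨₂ x ≡ x
  ∨₂-absorb {x} {y} y≤x = begin
    (y ⇝ x) ⇒ x  ≡⟨ cong (_⇒ x) (≤⇒⇝-top y≤x) ⟩
    𝟏 ⇒ x        ≡⟨ ⇒-unit x ⟩
    x            ∎
    where open ≡-Reasoning

module InternalStateFacts {a : Level} (A : PseudoBE a)
    {μ : PseudoBE.Carrier A → PseudoBE.Carrier A} (is : IsInternalStateII A μ) where
  open PseudoBE A
  open IsInternalStateII is
  open OrderFacts A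
  open ≡-Reasoning

  -- An internal state fixes the top element: instance x = y = 1 of (is2').
  μ-top : μ 𝟏 ≡ 𝟏
  μ-top = begin
    μ 𝟏                ≡⟨ cong μ (sym (⇒-refl 𝟏)) ⟩
    μ (𝟏 ⇒ 𝟏)          ≡⟨ is2′⇒ 𝟏 𝟏 ⟩
    μ (𝟏 ∨₁ 𝟏) ⇒ μ 𝟏   ≡⟨ cong (λ z → μ z ⇒ μ 𝟏) (∨₁-absorb (⇒-refl 𝟏)) ⟩
    μ 𝟏 ⇒ μ 𝟏          ≡⟨ ⇒-refl (μ 𝟏) ⟩
    𝟏                  ∎

  -- An internal state is idempotent: μ x = μ 1 → μ x is fixed by μ (is3).
  μ-idem : ∀ x → μ (μ x) ≡ μ x
  μ-idem x = begin
    μ (μ x)            ≡⟨ cong μ (sym μ1⇒μx) ⟩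
    μ (μ 𝟏 ⇒ μ x)      ≡⟨ is3⇒ 𝟏 x ⟩
    μ 𝟏 ⇒ μ x          ≡⟨ μ1⇒μx ⟩
    μ x                ∎
    where
    μ1⇒μx : μ 𝟏 ⇒ μ x ≡ μ x
    μ1⇒μx = trans (cong (_⇒ μ x) μ-top) (⇒-unit (μ x))

  -- On an increasing pair both sides of the homomorphism law for → are 1.
  hom⇒-increasing : ∀ {x y} → x ≤ y → μ (x ⇒ y) ≡ μ x ⇒ μ y
  hom⇒-increasing {x} {y} x≤y = begin
    μ (x ⇒ y)  ≡⟨ cong μ x≤y ⟩
    μ 𝟏        ≡⟨ μ-top ⟩
    𝟏          ≡⟨ sym (is1 x≤y) ⟩
    μ x ⇒ μ y  ∎

  -- On a decreasing pair (is2') is the homomorphism law for →, as y ∨₁ x = x.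
  hom⇒-decreasing : ∀ {x y} → y ≤ x → μ (x ⇒ y) ≡ μ x ⇒ μ y
  hom⇒-decreasing {x} {y} y≤x = begin
    μ (x ⇒ y)          ≡⟨ is2′⇒ x y ⟩
    μ (y ∨₁ x) ⇒ μ y   ≡⟨ cong (λ z → μ z ⇒ μ y) (∨₁-absorb y≤x) ⟩
    μ x ⇒ μ y          ∎

  hom⇝-increasing : ∀ {x y} → x ≤ y → μ (x ⇝ y) ≡ μ x ⇝ μ y
  hom⇝-increasing {x} {y} x≤y = begin
    μ (x ⇝ y)  ≡⟨ cong μ (≤⇒⇝-top x≤y) ⟩
    μ 𝟏        ≡⟨ μ-top ⟩
    𝟏          ≡⟨ sym (≤⇒⇝-top (is1 x≤y)) ⟩
    μ x ⇝ μ y  ∎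

  hom⇝-decreasing : ∀ {x y} → y ≤ x → μ (x ⇝ y) ≡ μ x ⇝ μ y
  hom⇝-decreasing {x} {y} y≤x = begin
    μ (x ⇝ y)          ≡⟨ is2′⇝ x y ⟩
    μ (y ∨₂ x) ⇝ μ y   ≡⟨ cong (λ z → μ z ⇝ μ y) (∨₂-absorb y≤x) ⟩
    μ x ⇝ μ y          ∎

proposition3p27 : {a : Level} (A : PseudoBE a) → LinearlyOrdered A →
    (μ : PseudoBE.Carrier A → PseudoBE.Carrier A) →
    IsInternalStateII A μ → IsStateMorphismOperator A μ
proposition3p27 A linear μ is = record { hom⇒ = hom⇒ ; hom⇝ = hom⇝ ; idem = μ-idem }
  where
  open PseudoBE A
  open InternalStateFacts A is

  hom⇒ : ∀ x y → μ (x ⇒ y) ≡ μ x ⇒ μ y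
  hom⇒ x y with linear x y
  ... | inj₁ x≤y = hom⇒-increasing x≤y
  ... | inj₂ y≤x = hom⇒-decreasing y≤x

  hom⇝ : ∀ x y → μ (x ⇝ y) ≡ μ x ⇝ μ y
  hom⇝ x y with linear x y
  ... | inj₁ x≤y = hom⇝-increasing x≤y
  ... | inj₂ y≤x = hom⇝-decreasing y≤x
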